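{- For every pair of integers $m$ and $n$ with $3 \le m \le n$, we have $\chi'_{st}(C_m \,\square\, C_n) \le 7$.
   Context: A star edge-coloring of a graph $G$ is a proper edge-coloring of $G$ in which there is no bichromatic path and no bichromatic cycle of length four (i.e., with four edges). The star chromatic index $\chi'_{st}(G)$ is the minimum number of colors in a star edge-coloring of $G$. $C_m$ denotes the cycle on $m$ vertices. $G \,\square\, H$ denotes the Cartesian product: vertex set $V(G)\times V(H)$, with $(u,v)(u',v')$ an edge iff either $uu'\in E(G)$ and $v=v'$, or $u=u'$ and $vv'\in E(H)$. -}

module Defs where

open import Data.Nat using (ℕ; suc)
open import Data.Fin using (Fin; toℕ)
open import Data.Product using (_×_; _,_; ∃; ∃-syntax)
open import Data.Sum using (_⊎_)
open import Data.Empty using (⊥)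
open import Relation.Nullary using (¬_)
open import Relation.Binary.PropositionalEquality using (_≡_; _≢_)

-- A graph given by a vertex type and an adjacency relation.
-- An edge-colouring with k colours: a colour for each edge {u,v},
-- given as a function on ordered pairs that is symmetric on edges.
record EdgeColouring (V : Set) (Adj : V → V → Set) (k : ℕ) : Set where
  field
    col  : V → V → Fin k
    colSym : ∀ {u v} → Adj u v → col u v ≡ col v u
open EdgeColouring public

module _ {V : Set} {Adj : V → V → Set} {k : ℕ} (c : EdgeColouring V Adj k) where
  private
    _~_ = Adj
    κ = col c

  Proper : Set
  Proper = ∀ {u v w} → u ~ v → u ~ w → v ≢ w → κ u v ≢ κ u w

  In2 : Fin k → Fin k → Fin k → Set
  In2 a b x = (x ≡ a) ⊎ (x ≡ b)

  NoBichromaticP4 : Set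
  NoBichromaticP4 =
    ∀ {v0 v1 v2 v3 v4} →
    v0 ≢ v1 → v0 ≢ v2 → v0 ≢ v3 → v0 ≢ v4 →
    v1 ≢ v2 → v1 ≢ v3 → v1 ≢ v4 →
    v2 ≢ v3 → v2 ≢ v4 → v3 ≢ v4 →
    v0 ~ v1 → v1 ~ v2 → v2 ~ v3 → v3 ~ v4 →
    ¬ (∃[ a ] ∃[ b ] (In2 a b (κ v0 v1) × In2 a b (κ v1 v2)
                    × In2 a b (κ v2 v3) × In2 a b (κ v3 v4)))

  NoBichromaticC4 : Set
  NoBichromaticC4 =
    ∀ {v0 v1 v2 v3} →
    v0 ≢ v1 → v0 ≢ v2 → v0 ≢ v3 → v1 ≢ v2 → v1 ≢ v3 → v2 ≢ v3 →
    v0 ~ v1 → v1 ~ v2 → v2 ~ v3 → v3 ~ v0 →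
    ¬ (∃[ a ] ∃[ b ] (In2 a b (κ v0 v1) × In2 a b (κ v1 v2)
                    × In2 a b (κ v2 v3) × In2 a b (κ v3 v0)))

  IsStarEdgeColouring : Set
  IsStarEdgeColouring = Proper × NoBichromaticP4 × NoBichromaticC4

StarChromaticIndex≤ : (V : Set) → (V → V → Set) → ℕ → Set
StarChromaticIndex≤ V Adj k = ∃[ c ] IsStarEdgeColouring {V} {Adj} {k} c

CycSucc : (m : ℕ) → Fin m → Fin m → Set
CycSucc m i j = (toℕ j ≡ suc (toℕ i)) ⊎ ((suc (toℕ i) ≡ m) × (toℕ j ≡ 0))

CycAdj : (m : ℕ) → Fin m → Fin m → Set
CycAdj m i j = CycSucc m i j ⊎ CycSucc m j i

BoxAdj : {A B : Set} → (A → A → Set) → (B → B → Set) → A × B → A × B → Set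
BoxAdj RA RB (a , b) (a' , b') = (RA a a' × b ≡ b') ⊎ (a ≡ a' × RB b b')

CmBoxCn : (m n : ℕ) → Fin m × Fin n → Fin m × Fin n → Set
CmBoxCn m n = BoxAdj (CycAdj m) (CycAdj n)

module Submission where

-- Label the vertices of each cycle C_N by a closed walk of length N in a fixed
-- digraph Γ on twelve labels: a directed triangle a₀a₁a₂ and a directed square
-- b₀b₁b₂b₃ which may follow each other (a₂ → b₀, b₃ → a₀), and a directed
-- pentagon c₀…c₄.  Such a walk exists for every N ≥ 3, as N = 5 or N is a sum of
-- 3s and 4s.  In C_m □ C_n the edge from (i , j) to its right (upper) neighbour
-- gets the colour horizontal (label i) (label j) (vertical (label i) (label j))
-- from two fixed 12 × 12 tables with seven colours.  In a proper colouring a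
-- bichromatic path or cycle with four edges alternates, and whether it does only
-- depends on the labels at offsets −2 … +1 around its middle vertex in both
-- coordinates.  These labels form two walks of length 3 in Γ, so one finite
-- computation over all pairs of such walks settles every torus at once.

open import Defs
open import Data.Bool using (Bool; true; T; _∧_; _∨_)
open import Data.Bool.Properties using (T?; T-∧; T-∨)
open import Data.Fin using (Fin; zero; suc; toℕ; fromℕ; inject₁)
open import Data.Fin.Patterns using (0F; 1F; 2F; 3F; 4F; 5F; 6F)
open import Data.Fin.Properties using (_≟_; any?; toℕ-injective; toℕ-fromℕ; toℕ-inject₁; toℕ<n)
open import Data.Fin.Relation.Unary.Top using (View; view; ‵fromℕ; ‵inject₁)
open import Data.List using (List; []; _∷_)
open import Data.List.Membership.Propositional using (_∈_)
open import Data.List.Relation.Unary.All as All using (All)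
open import Data.List.Relation.Unary.Any using (here; there)
open import Data.Nat using (ℕ; zero; suc; _+_; _≤_; s≤s; z≤n)
open import Data.Nat.Properties using (suc-injective; <-irrefl; 0≢1+n; 1+n≢n; n<1+n; m<n⇒m<1+n)
open import Data.Product using (_×_; _,_; proj₁; proj₂; ∃-syntax; uncurry)
open import Data.Product.Properties using (≡-dec)
open import Data.Sum using (_⊎_; inj₁; inj₂)
open import Data.Unit using (tt)
open import Data.Vec using (Vec; _++_; lookup; head) renaming ([] to []ᵛ; _∷_ to _∷ᵛ_)
open import Data.Vec.Relation.Unary.Linked using (Linked; [-]) renaming (_∷_ to _∷ˡ_)
open import Function using (_∘_)
open import Function.Bundles using (Equivalence)
open import Relation.Binary.Definitions using (DecidableEquality)
open import Relation.Binary.PropositionalEquality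
  using (_≡_; _≢_; refl; sym; trans; cong; subst; module ≡-Reasoning)
open import Relation.Nullary using (¬_; Dec; yes; no; contradiction)
open import Relation.Nullary.Decidable
  using (map′; _×-dec_; isYes; isNo; toWitness; toWitnessFalse)

two-values-alternate : ∀ {A : Set} {a b x y z : A} →
  x ≡ a ⊎ x ≡ b → y ≡ a ⊎ y ≡ b → z ≡ a ⊎ z ≡ b → x ≢ y → y ≢ z → x ≡ z
two-values-alternate (inj₁ refl) (inj₁ refl) _           x≢y _   = contradiction refl x≢y
two-values-alternate (inj₁ refl) (inj₂ refl) (inj₁ refl) _   _   = refl
two-values-alternate (inj₁ refl) (inj₂ refl) (inj₂ refl) _   y≢z = contradiction refl y≢z
two-values-alternate (inj₂ refl) (inj₂ refl) _           x≢y _   = contradiction refl x≢y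
two-values-alternate (inj₂ refl) (inj₁ refl) (inj₂ refl) _   _   = refl
two-values-alternate (inj₂ refl) (inj₁ refl) (inj₁ refl) _   y≢z = contradiction refl y≢z

Linked-lookup : ∀ {A : Set} {R : A → A → Set} {n} {xs : Vec A (suc n)} →
  Linked R xs → ∀ (j : Fin n) → R (lookup xs (inject₁ j)) (lookup xs (suc j))
Linked-lookup {xs = _ ∷ᵛ _ ∷ᵛ _} (r ∷ˡ _)  zero    = r
Linked-lookup                    (_ ∷ˡ rs) (suc j) = Linked-lookup rs j

-- Opaque, so that unification can read the predicate off a quantifier instead
-- of unfolding it; every-window-star unfolds them to run the check.
opaque
  allᵇ : ∀ {n} → (Fin n → Bool) → Bool
  allᵇ {zero}  p = true
  allᵇ {suc n} p = p zero ∧ allᵇ (p ∘ suc)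

  allᵇ-sound : ∀ {n} {p : Fin n → Bool} → T (allᵇ p) → ∀ i → T (p i)
  allᵇ-sound {suc n} h zero    = proj₁ (Equivalence.to T-∧ h)
  allᵇ-sound {suc n} h (suc i) = allᵇ-sound (proj₂ (Equivalence.to T-∧ h)) i

  all≢ᵇ : ∀ {n} → Fin n → (Fin n → Bool) → Bool
  all≢ᵇ c p = allᵇ λ i → isYes (i ≟ c) ∨ p i

  all≢ᵇ-sound : ∀ {n} {c} {p : Fin n → Bool} → T (all≢ᵇ c p) → ∀ i → i ≢ c → T (p i)
  all≢ᵇ-sound h i i≢c with Equivalence.to T-∨ (allᵇ-sound h i)
  ... | inj₁ i≡c = contradiction (toWitness i≡c) i≢c
  ... | inj₂ pi  = pi

infix 7 _≠_
_≠_ : ∀ {n} → Fin n → Fin n → Bool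
x ≠ y = isNo (x ≟ y)

≠-sound : ∀ {n} {x y : Fin n} → T (x ≠ y) → x ≢ y
≠-sound {x = x} {y} = toWitnessFalse {a? = x ≟ y}

module FinCycle where

  succ-functional : ∀ {N} {i j j′ : Fin N} → CycSucc N i j → CycSucc N i j′ → j ≡ j′
  succ-functional          (inj₁ e)          (inj₁ e′)         = toℕ-injective (trans e (sym e′))
  succ-functional {j = j}  (inj₁ e)          (inj₂ (last , _)) = contradiction (toℕ<n j) (<-irrefl (trans e last))
  succ-functional {j′ = j} (inj₂ (last , _)) (inj₁ e)          = contradiction (toℕ<n j) (<-irrefl (trans e last))
  succ-functional          (inj₂ (_ , z))    (inj₂ (_ , z′))   = toℕ-injective (trans z (sym z′))

  succ-injective : ∀ {N} {i j k : Fin N} → CycSucc N i k → CycSucc N j k → i ≡ j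
  succ-injective (inj₁ e)       (inj₁ e′)       = toℕ-injective (suc-injective (trans (sym e) e′))
  succ-injective (inj₁ e)       (inj₂ (_ , z))  = contradiction (trans (sym z) e) 0≢1+n
  succ-injective (inj₂ (_ , z)) (inj₁ e)        = contradiction (trans (sym z) e) 0≢1+n
  succ-injective (inj₂ (l , _)) (inj₂ (l′ , _)) = toℕ-injective (suc-injective (trans l (sym l′)))

  succ-irreflexive : ∀ {n} {i : Fin (2 + n)} → ¬ CycSucc (2 + n) i i
  succ-irreflexive (inj₁ e)       = 1+n≢n (sym e)
  succ-irreflexive (inj₂ (l , z)) = contradiction (trans (cong suc (sym z)) l) λ ()

  succ-asymmetric : ∀ {n} {i j : Fin (3 + n)} → CycSucc (3 + n) i j → ¬ CycSucc (3 + n) j i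
  succ-asymmetric (inj₁ e)       (inj₁ e′)      = <-irrefl (trans e′ (cong suc e)) (m<n⇒m<1+n (n<1+n _))
  succ-asymmetric (inj₁ e)       (inj₂ (l , z)) =
    contradiction (trans (cong (2 +_) (sym z)) (trans (cong suc (sym e)) l)) λ ()
  succ-asymmetric (inj₂ (l , z)) (inj₁ e)       =
    contradiction (trans (cong (2 +_) (sym z)) (trans (cong suc (sym e)) l)) λ ()
  succ-asymmetric (inj₂ (_ , z)) (inj₂ (l , _)) = contradiction (trans (cong suc (sym z)) l) λ ()

  private
    next-on : ∀ {n} {i : Fin (suc n)} → View i → Fin (suc n)
    next-on ‵fromℕ       = zero
    next-on (‵inject₁ j) = suc j

  next : ∀ {n} → Fin (suc n) → Fin (suc n)
  next i = next-on (view i)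

  prev : ∀ {n} → Fin (suc n) → Fin (suc n)
  prev zero    = fromℕ _
  prev (suc j) = inject₁ j

  next-succ : ∀ {n} (i : Fin (suc n)) → CycSucc (suc n) i (next i)
  next-succ i = go (view i)
    where
    go : ∀ {n} {i : Fin (suc n)} (v : View i) → CycSucc (suc n) i (next-on v)
    go {n} ‵fromℕ   = inj₂ (cong suc (toℕ-fromℕ n) , refl)
    go (‵inject₁ j) = inj₁ (cong suc (sym (toℕ-inject₁ j)))

  prev-succ : ∀ {n} (i : Fin (suc n)) → CycSucc (suc n) (prev i) i
  prev-succ {n} zero = inj₂ (cong suc (toℕ-fromℕ n) , refl)
  prev-succ (suc j)  = inj₁ (cong suc (sym (toℕ-inject₁ j)))

  prev-next : ∀ {n} (i : Fin (suc n)) → prev (next i) ≡ i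
  prev-next i = succ-injective (prev-succ (next i)) (next-succ i)

  next-prev : ∀ {n} (i : Fin (suc n)) → next (prev i) ≡ i
  next-prev i = succ-functional (next-succ (prev i)) (prev-succ i)

  next≢id : ∀ {n} (i : Fin (2 + n)) → next i ≢ i
  next≢id i eq = succ-irreflexive (subst (CycSucc _ i) eq (next-succ i))

  next≢prev : ∀ {n} (i : Fin (3 + n)) → next i ≢ prev i
  next≢prev i eq = succ-asymmetric (next-succ i) (subst (λ k → CycSucc _ k i) (sym eq) (prev-succ i))

  CycAdj⇒next⊎prev : ∀ {n} {i j : Fin (suc n)} → CycAdj (suc n) i j → j ≡ next i ⊎ j ≡ prev i
  CycAdj⇒next⊎prev {i = i} (inj₁ i→j) = inj₁ (succ-functional i→j (next-succ i))
  CycAdj⇒next⊎prev {i = i} (inj₂ j→i) = inj₂ (succ-injective j→i (prev-succ i))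

  Linked-next : ∀ {A : Set} {R : A → A → Set} {n} {xs : Vec A (suc n)} → Linked R xs →
    R (lookup xs (fromℕ n)) (lookup xs zero) → ∀ i → R (lookup xs i) (lookup xs (next i))
  Linked-next {R = R} {xs = xs} linked closing i = go (view i)
    where
    go : ∀ {i} (v : View i) → R (lookup xs i) (lookup xs (next-on v))
    go ‵fromℕ       = closing
    go (‵inject₁ j) = Linked-lookup linked j

-- The label digraph Γ

data Label : Set where
  a₀ a₁ a₂ b₀ b₁ b₂ b₃ c₀ c₁ c₂ c₃ c₄ : Label

successors : Label → List Label
successors a₀ = a₁ ∷ []
successors a₁ = a₂ ∷ []
successors a₂ = a₀ ∷ b₀ ∷ []
successors b₀ = b₁ ∷ []
successors b₁ = b₂ ∷ []
successors b₂ = b₃ ∷ []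
successors b₃ = b₀ ∷ a₀ ∷ []
successors c₀ = c₁ ∷ []
successors c₁ = c₂ ∷ []
successors c₂ = c₃ ∷ []
successors c₃ = c₄ ∷ []
successors c₄ = c₀ ∷ []

infix 4 _↝_
_↝_ : Label → Label → Set
x ↝ y = y ∈ successors x

∀-Label? : {P : Label → Set} → (∀ x → Dec (P x)) → Dec (∀ x → P x)
∀-Label? P? =
  map′ (λ (p₀ , p₁ , p₂ , q₀ , q₁ , q₂ , q₃ , r₀ , r₁ , r₂ , r₃ , r₄) → λ
         { a₀ → p₀ ; a₁ → p₁ ; a₂ → p₂ ; b₀ → q₀ ; b₁ → q₁ ; b₂ → q₂ ; b₃ → q₃
         ; c₀ → r₀ ; c₁ → r₁ ; c₂ → r₂ ; c₃ → r₃ ; c₄ → r₄ })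
       (λ p → p a₀ , p a₁ , p a₂ , p b₀ , p b₁ , p b₂ , p b₃ , p c₀ , p c₁ , p c₂ , p c₃ , p c₄)
       (P? a₀ ×-dec P? a₁ ×-dec P? a₂ ×-dec P? b₀ ×-dec P? b₁ ×-dec P? b₂ ×-dec P? b₃
        ×-dec P? c₀ ×-dec P? c₁ ×-dec P? c₂ ×-dec P? c₃ ×-dec P? c₄)

ClosedWalk : ∀ {n} → Vec Label (suc n) → Set
ClosedWalk {n} w = Linked _↝_ w × lookup w (fromℕ n) ↝ lookup w zero

triangle : Vec Label 3
triangle = a₀ ∷ᵛ a₁ ∷ᵛ a₂ ∷ᵛ []ᵛ

square : Vec Label 4
square = b₀ ∷ᵛ b₁ ∷ᵛ b₂ ∷ᵛ b₃ ∷ᵛ []ᵛ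

pentagon : Vec Label 5
pentagon = c₀ ∷ᵛ c₁ ∷ᵛ c₂ ∷ᵛ c₃ ∷ᵛ c₄ ∷ᵛ []ᵛ

longWord : ∀ j → Vec Label (6 + j)
longWord 0                   = triangle ++ triangle
longWord 1                   = triangle ++ square
longWord 2                   = square ++ square
longWord (suc (suc (suc j))) = triangle ++ longWord j

a₂↝head : ∀ j → a₂ ↝ head (longWord j)
a₂↝head 0                   = here refl
a₂↝head 1                   = here refl
a₂↝head 2                   = there (here refl)
a₂↝head (suc (suc (suc j))) = here refl

last↝a₀ : ∀ j → lookup (longWord j) (fromℕ (5 + j)) ↝ a₀
last↝a₀ 0                   = here refl
last↝a₀ 1                   = there (here refl)
last↝a₀ 2                   = there (here refl)
last↝a₀ (suc (suc (suc j))) = last↝a₀ j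

longWord-linked : ∀ j → Linked _↝_ (longWord j)
longWord-linked 0 = here refl ∷ˡ here refl ∷ˡ here refl ∷ˡ here refl ∷ˡ here refl ∷ˡ [-]
longWord-linked 1 =
  here refl ∷ˡ here refl ∷ˡ there (here refl) ∷ˡ here refl ∷ˡ here refl ∷ˡ here refl ∷ˡ [-]
longWord-linked 2 =
  here refl ∷ˡ here refl ∷ˡ here refl ∷ˡ here refl ∷ˡ here refl ∷ˡ here refl ∷ˡ here refl ∷ˡ [-]
longWord-linked (suc (suc (suc j))) = here refl ∷ˡ here refl ∷ˡ a₂↝head j ∷ˡ longWord-linked j

longWord-closed : ∀ j → ClosedWalk (longWord j)
longWord-closed j = longWord-linked j , closing j
  where
  closing : ∀ j → lookup (longWord j) (fromℕ (5 + j)) ↝ lookup (longWord j) zero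
  closing 0                   = last↝a₀ 0
  closing 1                   = last↝a₀ 1
  closing 2                   = here refl
  closing (suc (suc (suc j))) = last↝a₀ j

cycleWord : ∀ k → Vec Label (3 + k)
cycleWord 0                   = triangle
cycleWord 1                   = square
cycleWord 2                   = pentagon
cycleWord (suc (suc (suc j))) = longWord j

cycleWord-closed : ∀ k → ClosedWalk (cycleWord k)
cycleWord-closed 0                   = here refl ∷ˡ here refl ∷ˡ [-] , here refl
cycleWord-closed 1                   = here refl ∷ˡ here refl ∷ˡ here refl ∷ˡ [-] , here refl
cycleWord-closed 2                   = here refl ∷ˡ here refl ∷ˡ here refl ∷ˡ here refl ∷ˡ [-] , here refl
cycleWord-closed (suc (suc (suc j))) = longWord-closed j

-- Colour tables and the window check

byLabel : {A : Set} → A → A → A → A → A → A → A → A → A → A → A → A → Label → A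
byLabel x₀ _ _ _ _ _ _ _ _ _ _ _ a₀ = x₀
byLabel _ x₁ _ _ _ _ _ _ _ _ _ _ a₁ = x₁
byLabel _ _ x₂ _ _ _ _ _ _ _ _ _ a₂ = x₂
byLabel _ _ _ y₀ _ _ _ _ _ _ _ _ b₀ = y₀
byLabel _ _ _ _ y₁ _ _ _ _ _ _ _ b₁ = y₁
byLabel _ _ _ _ _ y₂ _ _ _ _ _ _ b₂ = y₂
byLabel _ _ _ _ _ _ y₃ _ _ _ _ _ b₃ = y₃
byLabel _ _ _ _ _ _ _ z₀ _ _ _ _ c₀ = z₀
byLabel _ _ _ _ _ _ _ _ z₁ _ _ _ c₁ = z₁
byLabel _ _ _ _ _ _ _ _ _ z₂ _ _ c₂ = z₂
byLabel _ _ _ _ _ _ _ _ _ _ z₃ _ c₃ = z₃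
byLabel _ _ _ _ _ _ _ _ _ _ _ z₄ c₄ = z₄

Colour : Set
Colour = Fin 7

horizontal vertical : Label → Label → Colour
horizontal = byLabel
  (byLabel 3F 5F 5F 3F 2F 6F 2F 0F 6F 2F 1F 0F)
  (byLabel 1F 1F 3F 1F 3F 5F 6F 1F 1F 5F 2F 4F)
  (byLabel 6F 0F 4F 6F 0F 3F 4F 4F 5F 4F 5F 3F)
  (byLabel 3F 6F 5F 3F 6F 0F 0F 5F 6F 0F 4F 0F)
  (byLabel 4F 5F 6F 4F 3F 4F 3F 2F 4F 2F 1F 2F)
  (byLabel 0F 4F 0F 0F 4F 1F 0F 0F 0F 3F 2F 5F)
  (byLabel 6F 0F 4F 6F 0F 3F 4F 4F 2F 4F 5F 4F)
  (byLabel 3F 3F 2F 3F 0F 3F 5F 3F 0F 5F 3F 0F)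
  (byLabel 1F 4F 0F 1F 3F 1F 6F 1F 2F 0F 6F 4F)
  (byLabel 0F 6F 3F 2F 5F 6F 0F 0F 5F 1F 0F 2F)
  (byLabel 6F 3F 1F 6F 3F 4F 3F 1F 2F 5F 1F 3F)
  (byLabel 2F 5F 6F 2F 1F 6F 1F 2F 4F 6F 5F 6F)
vertical = byLabel
  (byLabel 4F 2F 1F 4F 5F 0F 1F 3F 1F 0F 6F 2F)
  (byLabel 4F 6F 0F 5F 4F 1F 0F 3F 4F 6F 3F 5F)
  (byLabel 2F 6F 5F 2F 1F 0F 5F 2F 0F 3F 1F 6F)
  (byLabel 4F 2F 1F 4F 5F 2F 1F 3F 1F 2F 6F 2F)
  (byLabel 2F 3F 0F 2F 1F 6F 5F 0F 3F 5F 3F 1F)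
  (byLabel 6F 1F 2F 6F 5F 6F 2F 3F 1F 6F 4F 6F)
  (byLabel 1F 3F 5F 1F 2F 6F 5F 5F 6F 0F 3F 1F)
  (byLabel 0F 1F 4F 5F 2F 0F 4F 5F 1F 2F 1F 4F)
  (byLabel 6F 1F 5F 6F 4F 0F 2F 6F 3F 4F 1F 5F)
  (byLabel 2F 5F 4F 0F 2F 3F 4F 6F 4F 2F 5F 3F)
  (byLabel 1F 2F 5F 4F 1F 2F 5F 4F 0F 3F 4F 6F)
  (byLabel 0F 4F 3F 0F 2F 5F 4F 6F 3F 4F 0F 5F)

Dir : Set
Dir = Fin 4

pattern right = 0F
pattern left  = 1F
pattern up    = 2F
pattern down  = 3F

opposite : Dir → Dir
opposite right = left
opposite left  = right
opposite up    = down
opposite down  = up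

-- A horizontal (vertical) edge is coloured from the labels of its left (lower)
-- end, so offsets −2 … +1 from the middle vertex cover all edges of a path with
-- four edges.  back −2 = −2 is junk and never read.
data Offset : Set where
  −2 −1 ±0 +1 : Offset

back : Offset → Offset
back −2 = −2
back −1 = −2
back ±0 = −1
back +1 = ±0

Position : Set
Position = Offset × Offset

centre : Position
centre = ±0 , ±0

neighbour : Dir → Position
neighbour right = +1 , ±0
neighbour left  = −1 , ±0
neighbour up    = ±0 , +1
neighbour down  = ±0 , −1

Window : Set
Window = Offset → Label

walk : Label → Label → Label → Label → Window
walk x _ _ _ −2 = x
walk _ x _ _ −1 = x
walk _ _ x _ ±0 = x
walk _ _ _ x +1 = x

module Window (wx wy : Window) where

  colour : Dir → Position → Colour
  colour right (x , y) = horizontal (wx x)        (wy y)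
  colour left  (x , y) = horizontal (wx (back x)) (wy y)
  colour up    (x , y) = vertical   (wx x)        (wy y)
  colour down  (x , y) = vertical   (wx x)        (wy (back y))

  colour-opposite-neighbour : ∀ d → colour (opposite d) (neighbour d) ≡ colour d centre
  colour-opposite-neighbour right = refl
  colour-opposite-neighbour left  = refl
  colour-opposite-neighbour up    = refl
  colour-opposite-neighbour down  = refl

  ProperAtCentre : Set
  ProperAtCentre = ∀ d d′ → d ≢ d′ → colour d centre ≢ colour d′ centre

  -- The path v₀ v₁ centre v₃ v₄ with v₁ = neighbour e₂, v₃ = neighbour e₃, whose
  -- outer edges leave v₁ and v₃ in directions e₁ and e₄; the hypotheses say that
  -- it never steps straight back.
  NoAlternatingPath : Set
  NoAlternatingPath =
    ∀ e₂ e₁ → e₁ ≢ opposite e₂ → ∀ e₃ → e₃ ≢ e₂ → ∀ e₄ → e₄ ≢ opposite e₃ →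
    ¬ (colour e₁ (neighbour e₂) ≡ colour e₃ centre × colour e₂ centre ≡ colour e₄ (neighbour e₃))

  StarAtCentre : Set
  StarAtCentre = ProperAtCentre × NoAlternatingPath

  properᵇ : Bool
  properᵇ = allᵇ λ d → all≢ᵇ d λ d′ → colour d′ centre ≠ colour d centre

  properᵇ-sound : T properᵇ → ProperAtCentre
  properᵇ-sound h d d′ d≢d′ = ≠-sound (all≢ᵇ-sound (allᵇ-sound h d′) d d≢d′)

  noAlternatingPathᵇ : Bool
  noAlternatingPathᵇ =
    allᵇ λ e₂ → all≢ᵇ (opposite e₂) λ e₁ → all≢ᵇ e₂ λ e₃ → all≢ᵇ (opposite e₃) λ e₄ →
    colour e₁ (neighbour e₂) ≠ colour e₃ centre ∨ colour e₂ centre ≠ colour e₄ (neighbour e₃)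

  noAlternatingPathᵇ-sound : T noAlternatingPathᵇ → NoAlternatingPath
  noAlternatingPathᵇ-sound h e₂ e₁ n₁ e₃ n₃ e₄ n₄ (eq₁₃ , eq₂₄)
    with Equivalence.to T-∨ (all≢ᵇ-sound (all≢ᵇ-sound (all≢ᵇ-sound (allᵇ-sound h e₂) e₁ n₁) e₃ n₃) e₄ n₄)
  ... | inj₁ ≠₁₃ = ≠-sound ≠₁₃ eq₁₃
  ... | inj₂ ≠₂₄ = ≠-sound ≠₂₄ eq₂₄

  starAtCentreᵇ : Bool
  starAtCentreᵇ = properᵇ ∧ noAlternatingPathᵇ

  starAtCentreᵇ-sound : T starAtCentreᵇ → StarAtCentre
  starAtCentreᵇ-sound h = let hp , ha = Equivalence.to T-∧ h in properᵇ-sound hp , noAlternatingPathᵇ-sound ha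

opaque
  AllWalks : (Window → Set) → Set
  AllWalks P = ∀ x₀ → All (λ x₁ → All (λ x₂ → All (λ x₃ → P (walk x₀ x₁ x₂ x₃))
                        (successors x₂)) (successors x₁)) (successors x₀)

  allWalks? : {P : Window → Set} → (∀ w → Dec (P w)) → Dec (AllWalks P)
  allWalks? P? = ∀-Label? λ x₀ → All.all? (λ x₁ → All.all? (λ x₂ → All.all? (λ x₃ →
                   P? (walk x₀ x₁ x₂ x₃)) _) _) _

  AllWalks-walk : ∀ {P x₀ x₁ x₂ x₃} → AllWalks P → x₀ ↝ x₁ → x₁ ↝ x₂ → x₂ ↝ x₃ → P (walk x₀ x₁ x₂ x₃)
  AllWalks-walk h s₁ s₂ s₃ = All.lookup (All.lookup (All.lookup (h _) s₁) s₂) s₃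

opaque
  unfolding allᵇ all≢ᵇ allWalks?

  every-window-star : AllWalks λ wx → AllWalks λ wy → T (Window.starAtCentreᵇ wx wy)
  every-window-star =
    toWitness {a? = allWalks? λ wx → allWalks? λ wy → T? (Window.starAtCentreᵇ wx wy)} tt

-- Labelled cycles and their Cartesian product

record LabelledCycle : Set₁ where
  field
    Vertex      : Set
    _~_         : Vertex → Vertex → Set
    _≟ᵥ_        : DecidableEquality Vertex
    next prev   : Vertex → Vertex
    prev-next   : ∀ i → prev (next i) ≡ i
    next-prev   : ∀ i → next (prev i) ≡ i
    next≢id     : ∀ i → next i ≢ i
    next≢prev   : ∀ i → next i ≢ prev i
    ~⇒next⊎prev : ∀ {i j} → i ~ j → j ≡ next i ⊎ j ≡ prev i
    label       : Vertex → Label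
    label-next  : ∀ i → label i ↝ label (next i)

  prev≢id : ∀ i → prev i ≢ i
  prev≢id i eq = next≢id i (trans (cong next (sym eq)) (next-prev i))

  label-prev : ∀ i → label (prev i) ↝ label i
  label-prev i = subst (λ j → label (prev i) ↝ label j) (next-prev i) (label-next (prev i))

  window : Vertex → Window
  window i = walk (label (prev (prev i))) (label (prev i)) (label i) (label (next i))

  AllWalks-window : ∀ {P} → AllWalks P → ∀ i → P (window i)
  AllWalks-window h i = AllWalks-walk h (label-prev (prev i)) (label-prev i) (label-next i)

labelledCycle : ∀ {n} (w : Vec Label (3 + n)) → ClosedWalk w → LabelledCycle
labelledCycle {n} w closed = record
  { Vertex      = Fin (3 + n)
  ; _~_         = CycAdj (3 + n)
  ; _≟ᵥ_        = _≟_
  ; next        = next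
  ; prev        = prev
  ; prev-next   = prev-next
  ; next-prev   = next-prev
  ; next≢id     = next≢id
  ; next≢prev   = next≢prev
  ; ~⇒next⊎prev = CycAdj⇒next⊎prev
  ; label       = lookup w
  ; label-next  = uncurry Linked-next closed
  }
  where open FinCycle

module Torus (A B : LabelledCycle) where
  private
    module A = LabelledCycle A
    module B = LabelledCycle B

  Vertex : Set
  Vertex = A.Vertex × B.Vertex

  _~_ : Vertex → Vertex → Set
  _~_ = BoxAdj A._~_ B._~_

  _≟ᵥ_ : DecidableEquality Vertex
  _≟ᵥ_ = ≡-dec A._≟ᵥ_ B._≟ᵥ_

  move : Dir → Vertex → Vertex
  move right (i , j) = A.next i , j
  move left  (i , j) = A.prev i , j
  move up    (i , j) = i , B.next j
  move down  (i , j) = i , B.prev j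

  move-opposite : ∀ d v → move (opposite d) (move d v) ≡ v
  move-opposite right (i , j) = cong (_, j) (A.prev-next i)
  move-opposite left  (i , j) = cong (_, j) (A.next-prev i)
  move-opposite up    (i , j) = cong (i ,_) (B.prev-next j)
  move-opposite down  (i , j) = cong (i ,_) (B.next-prev j)

  move-injective : ∀ {d d′} v → move d v ≡ move d′ v → d ≡ d′
  move-injective {right} {right} _       _  = refl
  move-injective {right} {left}  (i , _) eq = contradiction (cong proj₁ eq) (A.next≢prev i)
  move-injective {right} {up}    (i , _) eq = contradiction (cong proj₁ eq) (A.next≢id i)
  move-injective {right} {down}  (i , _) eq = contradiction (cong proj₁ eq) (A.next≢id i)
  move-injective {left}  {right} (i , _) eq = contradiction (sym (cong proj₁ eq)) (A.next≢prev i)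
  move-injective {left}  {left}  _       _  = refl
  move-injective {left}  {up}    (i , _) eq = contradiction (cong proj₁ eq) (A.prev≢id i)
  move-injective {left}  {down}  (i , _) eq = contradiction (cong proj₁ eq) (A.prev≢id i)
  move-injective {up}    {right} (i , _) eq = contradiction (sym (cong proj₁ eq)) (A.next≢id i)
  move-injective {up}    {left}  (i , _) eq = contradiction (sym (cong proj₁ eq)) (A.prev≢id i)
  move-injective {up}    {up}    _       _  = refl
  move-injective {up}    {down}  (_ , j) eq = contradiction (cong proj₂ eq) (B.next≢prev j)
  move-injective {down}  {right} (i , _) eq = contradiction (sym (cong proj₁ eq)) (A.next≢id i)
  move-injective {down}  {left}  (i , _) eq = contradiction (sym (cong proj₁ eq)) (A.prev≢id i)
  move-injective {down}  {up}    (_ , j) eq = contradiction (sym (cong proj₂ eq)) (B.next≢prev j)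
  move-injective {down}  {down}  _       _  = refl

  adjacent⇒move : ∀ {u v} → u ~ v → ∃[ d ] v ≡ move d u
  adjacent⇒move {i , _} (inj₁ (i~i′ , refl)) with A.~⇒next⊎prev i~i′
  ... | inj₁ refl = right , refl
  ... | inj₂ refl = left , refl
  adjacent⇒move {_ , j} (inj₂ (refl , j~j′)) with B.~⇒next⊎prev j~j′
  ... | inj₁ refl = up , refl
  ... | inj₂ refl = down , refl

  adjacent⇒move⁻ : ∀ {u v} → u ~ v → ∃[ d ] u ≡ move d v
  adjacent⇒move⁻ u~v with adjacent⇒move u~v
  ... | d , refl = opposite d , sym (move-opposite d _)

  windowColour : Vertex → Dir → Position → Colour
  windowColour (i , j) = Window.colour (A.window i) (B.window j)

  colourAt : Dir → Vertex → Colour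
  colourAt d v = windowColour v d centre

  colourAt-move : ∀ e d v → colourAt d (move e v) ≡ windowColour v d (neighbour e)
  colourAt-move right right _       = refl
  colourAt-move right left  (i , j) = cong (λ i′ → horizontal (A.label i′) (B.label j)) (A.prev-next i)
  colourAt-move right up    _       = refl
  colourAt-move right down  _       = refl
  colourAt-move left  right _       = refl
  colourAt-move left  left  _       = refl
  colourAt-move left  up    _       = refl
  colourAt-move left  down  _       = refl
  colourAt-move up    right _       = refl
  colourAt-move up    left  _       = refl
  colourAt-move up    up    _       = refl
  colourAt-move up    down  (i , j) = cong (λ j′ → vertical (A.label i) (B.label j′)) (B.prev-next j)
  colourAt-move down  right _       = refl
  colourAt-move down  left  _       = refl
  colourAt-move down  up    _       = refl
  colourAt-move down  down  _       = refl

  colourAt-opposite : ∀ d v → colourAt (opposite d) (move d v) ≡ colourAt d v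
  colourAt-opposite d v@(i , j) =
    trans (colourAt-move d (opposite d) v) (Window.colour-opposite-neighbour (A.window i) (B.window j) d)

  starAt : ∀ v → Window.StarAtCentre (A.window (proj₁ v)) (B.window (proj₂ v))
  starAt (i , j) = Window.starAtCentreᵇ-sound _ _ (B.AllWalks-window (A.AllWalks-window every-window-star i) j)

  colourAt-distinct : ∀ {d d′} v → move d v ≢ move d′ v → colourAt d v ≢ colourAt d′ v
  colourAt-distinct v ne = proj₁ (starAt v) _ _ (λ d≡d′ → ne (cong (λ d → move d v) d≡d′))

  colour : Vertex → Vertex → Colour
  colour u v = fromDirection (any? λ d → v ≟ᵥ move d u)
    where
    fromDirection : Dec (∃[ d ] v ≡ move d u) → Colour
    fromDirection (yes (d , _)) = colourAt d u
    fromDirection (no _)        = 0F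

  colour-move : ∀ d u → colour u (move d u) ≡ colourAt d u
  colour-move d u with any? (λ d′ → move d u ≟ᵥ move d′ u)
  ... | yes (d′ , eq) = cong (λ d → colourAt d u) (move-injective u (sym eq))
  ... | no ∄d         = contradiction (d , refl) ∄d

  colour-reverse : ∀ d u → colour (move d u) u ≡ colourAt d u
  colour-reverse d u = begin
    colour (move d u) u                               ≡⟨ cong (colour (move d u)) (sym (move-opposite d u)) ⟩
    colour (move d u) (move (opposite d) (move d u))  ≡⟨ colour-move (opposite d) (move d u) ⟩
    colourAt (opposite d) (move d u)                  ≡⟨ colourAt-opposite d u ⟩
    colourAt d u                                      ∎
    where open ≡-Reasoning

  colour-sym : ∀ {u v} → u ~ v → colour u v ≡ colour v u
  colour-sym {u} u~v with adjacent⇒move u~v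
  ... | d , refl = trans (colour-move d u) (sym (colour-reverse d u))

  colouring : EdgeColouring Vertex _~_ 7
  colouring = record { col = colour ; colSym = colour-sym }

  proper : Proper colouring
  proper {u} u~v u~w v≢w with adjacent⇒move u~v | adjacent⇒move u~w
  ... | d , refl | d′ , refl = λ eq →
    colourAt-distinct u v≢w (trans (sym (colour-move d u)) (trans eq (colour-move d′ u)))

  consecutive-colours-differ : ∀ {v₀ v₁ v₂} → v₀ ~ v₁ → v₁ ~ v₂ → v₀ ≢ v₂ → colour v₀ v₁ ≢ colour v₁ v₂
  consecutive-colours-differ {v₁ = v₁} a₀₁ a₁₂ v₀≢v₂ with adjacent⇒move⁻ a₀₁ | adjacent⇒move a₁₂
  ... | d , refl | d′ , refl = λ eq →
    colourAt-distinct v₁ v₀≢v₂ (trans (sym (colour-reverse d v₁)) (trans eq (colour-move d′ v₁)))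

  no-alternating-path : ∀ v e₂ e₁ → e₁ ≢ opposite e₂ → ∀ e₃ → e₃ ≢ e₂ → ∀ e₄ → e₄ ≢ opposite e₃ →
    let v₁ = move e₂ v ; v₃ = move e₃ v in
    ¬ (colour (move e₁ v₁) v₁ ≡ colour v v₃ × colour v₁ v ≡ colour v₃ (move e₄ v₃))
  no-alternating-path v e₂ e₁ n₁ e₃ n₃ e₄ n₄ (eq₁₃ , eq₂₄) =
    proj₂ (starAt v) e₂ e₁ n₁ e₃ n₃ e₄ n₄
      (trans (sym c₀₁) (trans eq₁₃ c₂₃) , trans (sym c₁₂) (trans eq₂₄ c₃₄))
    where
    c₀₁ : colour (move e₁ (move e₂ v)) (move e₂ v) ≡ windowColour v e₁ (neighbour e₂)
    c₀₁ = trans (colour-reverse e₁ (move e₂ v)) (colourAt-move e₂ e₁ v)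
    c₁₂ : colour (move e₂ v) v ≡ colourAt e₂ v
    c₁₂ = colour-reverse e₂ v
    c₂₃ : colour v (move e₃ v) ≡ colourAt e₃ v
    c₂₃ = colour-move e₃ v
    c₃₄ : colour (move e₃ v) (move e₄ (move e₃ v)) ≡ windowColour v e₄ (neighbour e₃)
    c₃₄ = trans (colour-move e₄ (move e₃ v)) (colourAt-move e₃ e₄ v)

  no-alternating-walk : ∀ {v₀ v₁ v₂ v₃ v₄} → v₀ ~ v₁ → v₁ ~ v₂ → v₂ ~ v₃ → v₃ ~ v₄ →
    v₀ ≢ v₂ → v₁ ≢ v₃ → v₂ ≢ v₄ → ¬ (colour v₀ v₁ ≡ colour v₂ v₃ × colour v₁ v₂ ≡ colour v₃ v₄)
  no-alternating-walk {v₂ = v} a₀₁ a₁₂ a₂₃ a₃₄ n₀₂ n₁₃ n₂₄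
    with adjacent⇒move⁻ a₀₁ | adjacent⇒move⁻ a₁₂ | adjacent⇒move a₂₃ | adjacent⇒move a₃₄
  ... | e₁ , refl | e₂ , refl | e₃ , refl | e₄ , refl =
    no-alternating-path v e₂ e₁ (λ { refl → n₀₂ (move-opposite e₂ v) })
                          e₃ (λ { refl → n₁₃ refl })
                          e₄ (λ { refl → n₂₄ (sym (move-opposite e₃ v)) })

  no-bichromatic-walk : ∀ {v₀ v₁ v₂ v₃ v₄} → v₀ ~ v₁ → v₁ ~ v₂ → v₂ ~ v₃ → v₃ ~ v₄ →
    v₀ ≢ v₂ → v₁ ≢ v₃ → v₂ ≢ v₄ →
    ¬ (∃[ a ] ∃[ b ] (In2 colouring a b (colour v₀ v₁) × In2 colouring a b (colour v₁ v₂)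
                    × In2 colouring a b (colour v₂ v₃) × In2 colouring a b (colour v₃ v₄)))
  no-bichromatic-walk a₀₁ a₁₂ a₂₃ a₃₄ n₀₂ n₁₃ n₂₄ (_ , _ , h₀₁ , h₁₂ , h₂₃ , h₃₄) =
    no-alternating-walk a₀₁ a₁₂ a₂₃ a₃₄ n₀₂ n₁₃ n₂₄
      ( two-values-alternate h₀₁ h₁₂ h₂₃ (differ a₀₁ a₁₂ n₀₂) (differ a₁₂ a₂₃ n₁₃)
      , two-values-alternate h₁₂ h₂₃ h₃₄ (differ a₁₂ a₂₃ n₁₃) (differ a₂₃ a₃₄ n₂₄))
    where differ = consecutive-colours-differ

  no-bichromatic-P4 : NoBichromaticP4 colouring
  no-bichromatic-P4 _ n₀₂ _ _ _ n₁₃ _ _ n₂₄ _ a₀₁ a₁₂ a₂₃ a₃₄ = no-bichromatic-walk a₀₁ a₁₂ a₂₃ a₃₄ n₀₂ n₁₃ n₂₄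

  no-bichromatic-C4 : NoBichromaticC4 colouring
  no-bichromatic-C4 _ n₀₂ _ _ n₁₃ _ a₀₁ a₁₂ a₂₃ a₃₀ = no-bichromatic-walk a₀₁ a₁₂ a₂₃ a₃₀ n₀₂ n₁₃ (n₀₂ ∘ sym)

  torus-star : StarChromaticIndex≤ Vertex _~_ 7
  torus-star = colouring , proper , no-bichromatic-P4 , no-bichromatic-C4

theorem20 : (m n : ℕ) → 3 ≤ m → m ≤ n →
    StarChromaticIndex≤ (Fin m × Fin n) (CmBoxCn m n) 7
theorem20 (suc (suc (suc k))) (suc (suc (suc l))) (s≤s (s≤s (s≤s z≤n))) (s≤s (s≤s (s≤s _))) =
  Torus.torus-star (labelledCycle (cycleWord k) (cycleWord-closed k))
                   (labelledCycle (cycleWord l) (cycleWord-closed l))
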